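{- Let $n\ge1$, let $\widehat d,t$ be positive integers and $\vec\lambda=(\lambda_1,\dots,\lambda_m)$ positive integers with $n=\widehat d\,t\sum_i\lambda_i$. Let $q$ be a prime power with $q\equiv1\pmod n$ and $s=(q-1)/t$. Let $D$ be a multiple of $\widehat d$ dividing $\widehat d t$, and put $\widehat t=\widehat d t/D$. Let $\vec d=(d_1,\dots,d_m)$ with each $d_i$ a multiple of $\widehat d$ dividing $D$. Define $$Z(\vec d,t,\widehat d,\vec\lambda)=\sum\prod_{i=1}^m\alpha_i^{\lambda_i}(\zeta_n^{\widehat t}),$$ the sum over $m$-tuples $([\alpha_1],\dots,[\alpha_m])\in(\Gamma_D/\langle\delta^s\rangle)^m$ such that $[\alpha_i]$ and $[\alpha_j]$ lie in different Frobenius orbits for $i\ne j$, $\alpha_i$ has degree $d_i$, and $[\alpha_i]$ has newdegree $\widehat d$ (evaluations computed in $\Gamma_D$). If the entries of $\vec d$ are not all equal, then $Z(\vec d,t,\widehat d,\vec\lambda)=0$.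
   Context: $\Gamma_r=\mathrm{Hom}(\mathbb{F}_{q^r}^\times,\mathbb{C}^\times)$, embedded in $\Gamma_{r'}$ for $r\mid r'$ by composition with the norm; $\delta$ is a fixed generator of $\Gamma_1$, regarded in $\Gamma_D$; $[\alpha]$ is the class of $\alpha$ in $\Gamma_D/\langle\delta^s\rangle$. Frobenius acts by $\alpha\mapsto\alpha^q$; the degree of $\alpha$ is the size of its Frobenius orbit and the newdegree of $[\alpha]$ is the size of the Frobenius orbit of $[\alpha]$. $\zeta_n\in\mathbb{F}_q^\times$ has order $n$, and $\alpha(\zeta_n^{\widehat t})$ means evaluation of $\alpha\in\Gamma_D$ at $\zeta_n^{\widehat t}\in\mathbb{F}_q^\times\subset\mathbb{F}_{q^D}^\times$ (well defined on classes). -}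

module Defs where

open import Level using (Level)
open import Data.Bool using (Bool; true; false; _∧_; _∨_; not; if_then_else_)
open import Data.Nat using (ℕ; zero; suc; _+_; _*_; _∸_; _^_; _<ᵇ_; ∣_-_∣)
open import Data.Nat.Divisibility using (_∣?_)
open import Data.Fin using (Fin; _≟_)
open import Data.List using (List; []; _∷_; concatMap; map; upTo; foldr)
open import Data.Vec using (Vec; []; _∷_; lookup; allFin)
import Data.Vec as Vec
open import Relation.Nullary using (does)
open import Algebra.Bundles using (CommutativeRing)

-- Fix a generator g of F_{q^D}^×, N = q^D - 1.  A
-- character α ∈ Γ_D is encoded by its exponent a ∈ {0,…,N-1}, meaning
-- α(g) = ω^a for a fixed primitive N-th root of unity ω (in the
-- coefficient ring).  Hence α_a(g^k) = ω^(a*k), α_a^λ = α_{λa},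
-- Frobenius α ↦ α^q is a ↦ q*a, and group law is addition mod N.

congᵇ : ℕ → ℕ → ℕ → Bool
congᵇ N x y = does (N ∣? ∣ x - y ∣)

anyBelow : ℕ → (ℕ → Bool) → Bool
anyBelow zero    P = false
anyBelow (suc n) P = P n ∨ anyBelow n P

allBelow : ℕ → (ℕ → Bool) → Bool
allBelow zero    P = true
allBelow (suc n) P = P n ∧ allBelow n P

-- Working modulo the subgroup H = ⟨h₀⟩ ⊂ Z/N  (h₀ = exponent of δ^s).
-- x and y define the same class [·] in Γ_D/⟨δ^s⟩
sameClassᵇ : (N h₀ : ℕ) → ℕ → ℕ → Bool
sameClassᵇ N h₀ x y = anyBelow N (λ k → congᵇ N (x + k * h₀) y)

-- a is the chosen (least) representative of its class: this picks
-- exactly one element from each class of Γ_D/⟨δ^s⟩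
canonicalᵇ : (N h₀ : ℕ) → ℕ → Bool
canonicalᵇ N h₀ a = (a <ᵇ N) ∧ allBelow a (λ y → not (sameClassᵇ N h₀ y a))

degreeIsᵇ : (N q : ℕ) → ℕ → ℕ → Bool
degreeIsᵇ N q a zero    = false
degreeIsᵇ N q a (suc d) =
  congᵇ N (q ^ suc d * a) a
  ∧ allBelow d (λ e → not (congᵇ N (q ^ suc e * a) a))

newdegreeIsᵇ : (N h₀ q : ℕ) → ℕ → ℕ → Bool
newdegreeIsᵇ N h₀ q a zero    = false
newdegreeIsᵇ N h₀ q a (suc d) =
  sameClassᵇ N h₀ (q ^ suc d * a) a
  ∧ allBelow d (λ e → not (sameClassᵇ N h₀ (q ^ suc e * a) a))

-- [α_a] and [α_b] lie in the same Frobenius orbit (Frobenius has order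
-- D on Γ_D, so Frob^j for j < D exhaust the Frobenius group)
sameOrbitᵇ : (N h₀ q D : ℕ) → ℕ → ℕ → Bool
sameOrbitᵇ N h₀ q D a b = anyBelow D (λ j → sameClassᵇ N h₀ (q ^ j * a) b)

allTuples : (m N : ℕ) → List (Vec ℕ m)
allTuples zero    N = [] ∷ []
allTuples (suc m) N = concatMap (λ a → map (a ∷_) (allTuples m N)) (upTo N)

allFinᵇ : ∀ {m} → (Fin m → Bool) → Bool
allFinᵇ {m} P = Vec.foldr _ _∧_ true (Vec.map P (allFin m))

distinctOrbitsᵇ : (N h₀ q D : ℕ) → ∀ {m} → Vec ℕ m → Bool
distinctOrbitsᵇ N h₀ q D {m} a =
  allFinᵇ (λ i → allFinᵇ (λ j →
    if does (i ≟ j) then true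
    else not (sameOrbitᵇ N h₀ q D (lookup a i) (lookup a j))))

admissibleᵇ : (N h₀ q D dhat : ℕ) → ∀ {m} → (d : Vec ℕ m) → Vec ℕ m → Bool
admissibleᵇ N h₀ q D dhat d a =
  allFinᵇ (λ i → canonicalᵇ N h₀ (lookup a i))
  ∧ distinctOrbitsᵇ N h₀ q D a
  ∧ allFinᵇ (λ i → degreeIsᵇ N q (lookup a i) (lookup d i))
  ∧ allFinᵇ (λ i → newdegreeIsᵇ N h₀ q (lookup a i) dhat)

module _ {c ℓ : Level} (K : CommutativeRing c ℓ) where
  open CommutativeRing K using (Carrier; _≈_; _≉_; 0#; 1#)
    renaming (_+_ to _+ᴷ_; _*_ to _*ᴷ_)
  import Data.Nat as ℕ

  pow : Carrier → ℕ → Carrier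
  pow x zero    = 1#
  pow x (suc k) = x *ᴷ pow x k

  fromℕ : ℕ → Carrier
  fromℕ zero    = 0#
  fromℕ (suc k) = 1# +ᴷ fromℕ k

  PrimitiveRoot : Carrier → ℕ → Set ℓ
  PrimitiveRoot ω N =
    pow ω N ≈ 1# × (∀ k → 0 ℕ.< k → k ℕ.< N → pow ω k ≉ 1#)
    where open import Data.Product using (_×_)

  evalChar : (ω : Carrier) → (a k : ℕ) → Carrier
  evalChar ω a k = pow ω (a ℕ.* k)

  prodTerm : (ω : Carrier) (k : ℕ) → ∀ {m} → (lam a : Vec ℕ m) → Carrier
  prodTerm ω k []          []        = 1#
  prodTerm ω k (l ∷ lam)   (a ∷ as)  = pow (evalChar ω a k) l *ᴷ prodTerm ω k lam as

  -- Z(d, t, d̂, λ) with:  N = q^D - 1, h₀ = exponent of δ^s, ζ_n^{t̂} = g^k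
  Z : (ω : Carrier) (q D N h₀ k dhat : ℕ) → ∀ {m} → (d lam : Vec ℕ m) → Carrier
  Z ω q D N h₀ k dhat {m} d lam =
    foldr (λ a acc → (if admissibleᵇ N h₀ q D dhat d a then prodTerm ω k lam a else 0#) +ᴷ acc)
          0# (allTuples m N)

{-# OPTIONS --safe #-}
module Submission where

-- Twist by a Frobenius-invariant character.  Fix a value d₀ taken by the
-- entries of d⃗ and multiply the classes [α_i] with d_i = d₀ by the class of
-- the character of exponent M (a power of δ∘N).  It is fixed by Frobenius, so
-- degrees and newdegrees do not change, and an entry with d_i = d₀ and one
-- with d_j ≠ d₀ lie in different orbits before and after; hence the twist
-- permutes the index set of Z.  It multiplies every summand by
-- η = α_M(ζ_n^t̂)^Λ, where Λ = Σ_{d_i = d₀} λ_i.  As N(ζ_n^t̂) = ζ_n^(d̂ t),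
-- η = 1 would force n = d̂ t Σλ_i to divide d̂ t Λ, impossible since
-- 0 < Λ < Σλ_i.  So Z = η Z with η ≠ 1, whence Z = 0 in the integral domain K.

open import Algebra.Bundles using (CommutativeRing)
open import Data.Bool using (Bool; true; false; _∧_; _∨_; not; if_then_else_)
open import Data.Bool.Properties using (∧-conicalˡ; ∧-conicalʳ; ∧-zeroʳ; ¬-not; T-≡; ⇔→≡)
open import Data.Empty using (⊥-elim)
open import Data.Fin using (Fin) renaming (zero to fzero; suc to fsuc)
import Data.Fin as Fin
open import Data.List using (List; []; _∷_; _++_; map; foldr; concatMap; applyUpTo; upTo)
open import Data.Nat
import Data.Nat as ℕ
open import Data.Nat.Coprimality using (Coprime; coprime-Bézout)
open import Data.Nat.DivMod
open import Data.Nat.Divisibility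
  using (_∣_; divides; _∣?_; n∣m*n; m∣m*n; ∣n⇒∣m*n; ∣m+n∣m⇒∣n; ∣-trans; *-monoʳ-∣; *-monoˡ-∣; *-cancelˡ-∣; m%n≡0⇒n∣m; ∣⇒≤; 0∣⇒≡0)
open import Data.Nat.GCD using (module Bézout)
open import Data.Nat.Primality using (Prime; prime⇒nonTrivial; prime⇒nonZero)
open import Data.Nat.Properties
import Data.Nat.Properties as ℕ
open import Data.Nat.Tactic.RingSolver using (solve-∀)
open import Data.Product using (∃; ∃₂; _×_; _,_; proj₁)
open import Data.Sum using (_⊎_; inj₁; inj₂)
open import Data.Vec using (Vec; []; _∷_; lookup; sum; allFin)
import Data.Vec as Vec
import Data.Vec.Properties as Vec
open import Data.Vec.Membership.Propositional using (_∈_)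
open import Data.Vec.Membership.Propositional.Properties using (∈-allFin⁺)
open import Data.Vec.Relation.Unary.All using (All)
import Data.Vec.Relation.Unary.All.Properties as All
open import Data.Vec.Relation.Unary.Any using (here; there)
open import Function.Bundles using (_⇔_; mk⇔; Equivalence)
open import Function.Construct.Composition using (_⇔-∘_)
open import Function.Construct.Symmetry using (⇔-sym)
open import Level using (Level; 0ℓ)
open import Relation.Binary.Bundles using (Setoid)
open import Relation.Binary.Definitions using (tri<; tri≈; tri>)
open import Relation.Binary.PropositionalEquality
  using (_≡_; _≢_; refl; sym; trans; cong; cong₂; subst; subst₂; module ≡-Reasoning)
import Relation.Binary.Reasoning.Setoid as SetoidReasoning
open import Relation.Binary.Structures using (IsEquivalence)
open import Relation.Nullary using (¬_; does; yes; no)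
open import Relation.Nullary.Decidable using (dec-true; dec-false)

open import Defs

-- Congruences of natural numbers, without subtraction

Mod : ℕ → ℕ → ℕ → Set
Mod n x y = ∃₂ λ a b → x + a * n ≡ y + b * n

Mod-refl : ∀ {n x} → Mod n x x
Mod-refl = 0 , 0 , refl

Mod-reflexive : ∀ {n x y} → x ≡ y → Mod n x y
Mod-reflexive refl = Mod-refl

Mod-sym : ∀ {n x y} → Mod n x y → Mod n y x
Mod-sym (a , b , e) = b , a , sym e

Mod-trans : ∀ {n x y z} → Mod n x y → Mod n y z → Mod n x z
Mod-trans {n} {x} {y} {z} (a , b , e) (c , d , f) = a + c , b + d , (begin
  x + (a + c) * n      ≡⟨ regroup x a c n ⟩
  (x + a * n) + c * n  ≡⟨ cong (_+ c * n) e ⟩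
  (y + b * n) + c * n  ≡⟨ swap y b c n ⟩
  (y + c * n) + b * n  ≡⟨ cong (_+ b * n) f ⟩
  (z + d * n) + b * n  ≡⟨ swap z d b n ⟩
  (z + b * n) + d * n  ≡⟨ sym (regroup z b d n) ⟩
  z + (b + d) * n      ∎)
  where
  open ≡-Reasoning
  regroup : ∀ x a c n → x + (a + c) * n ≡ (x + a * n) + c * n
  regroup = solve-∀
  swap : ∀ y b c n → (y + b * n) + c * n ≡ (y + c * n) + b * n
  swap = solve-∀

Mod-isEquivalence : ∀ n → IsEquivalence (Mod n)
Mod-isEquivalence n = record { refl = Mod-refl ; sym = Mod-sym ; trans = Mod-trans }

Mod-setoid : ℕ → Setoid 0ℓ 0ℓ
Mod-setoid n = record { isEquivalence = Mod-isEquivalence n }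

module ModReasoning (n : ℕ) = SetoidReasoning (Mod-setoid n)

Mod-+ : ∀ {n x y x′ y′} → Mod n x x′ → Mod n y y′ → Mod n (x + y) (x′ + y′)
Mod-+ {n} {x} {y} {x′} {y′} (a , b , e) (c , d , f) = a + c , b + d , (begin
  x + y + (a + c) * n          ≡⟨ regroup x y a c n ⟩
  (x + a * n) + (y + c * n)    ≡⟨ cong₂ _+_ e f ⟩
  (x′ + b * n) + (y′ + d * n)  ≡⟨ sym (regroup x′ y′ b d n) ⟩
  x′ + y′ + (b + d) * n        ∎)
  where
  open ≡-Reasoning
  regroup : ∀ x y a c n → x + y + (a + c) * n ≡ (x + a * n) + (y + c * n)
  regroup = solve-∀

Mod-* : ∀ {n x y x′ y′} → Mod n x x′ → Mod n y y′ → Mod n (x * y) (x′ * y′)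
Mod-* {n} {x} {y} {x′} {y′} (a , b , e) (c , d , f) =
  a * y + x * c + a * c * n , b * y′ + x′ * d + b * d * n , (begin
  x * y + (a * y + x * c + a * c * n) * n        ≡⟨ expand x y a c n ⟩
  (x + a * n) * (y + c * n)                      ≡⟨ cong₂ _*_ e f ⟩
  (x′ + b * n) * (y′ + d * n)                    ≡⟨ sym (expand x′ y′ b d n) ⟩
  x′ * y′ + (b * y′ + x′ * d + b * d * n) * n    ∎)
  where
  open ≡-Reasoning
  expand : ∀ x y a c n → x * y + (a * y + x * c + a * c * n) * n ≡ (x + a * n) * (y + c * n)
  expand = solve-∀

Mod-*ˡ : ∀ {n} k {x y} → Mod n x y → Mod n (k * x) (k * y)
Mod-*ˡ k = Mod-* (Mod-refl {x = k})

Mod-*ʳ : ∀ {n} k {x y} → Mod n x y → Mod n (x * k) (y * k)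
Mod-*ʳ k x≡y = Mod-* x≡y (Mod-refl {x = k})

Mod-^ : ∀ {n x y} e → Mod n x y → Mod n (x ^ e) (y ^ e)
Mod-^ zero    _   = Mod-refl
Mod-^ (suc e) x≡y = Mod-* x≡y (Mod-^ e x≡y)

Mod-+-cancelʳ : ∀ {n x y} c → Mod n (x + c) (y + c) → Mod n x y
Mod-+-cancelʳ {n} {x} {y} c (a , b , e) = a , b , +-cancelʳ-≡ c _ _ (begin
  x + a * n + c  ≡⟨ swap x (a * n) c ⟩
  x + c + a * n  ≡⟨ e ⟩
  y + c + b * n  ≡⟨ swap y c (b * n) ⟩
  y + b * n + c  ∎)
  where
  open ≡-Reasoning
  swap : ∀ x y c → x + y + c ≡ x + c + y
  swap = solve-∀

Mod-scale : ∀ {t x y} u → Mod t x y → Mod (t * u) (x * u) (y * u)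
Mod-scale {t} {x} {y} u (a , b , e) = a , b , (begin
  x * u + a * (t * u)  ≡⟨ factor x a t u ⟩
  (x + a * t) * u      ≡⟨ cong (_* u) e ⟩
  (y + b * t) * u      ≡⟨ sym (factor y b t u) ⟩
  y * u + b * (t * u)  ∎)
  where
  open ≡-Reasoning
  factor : ∀ x a t u → x * u + a * (t * u) ≡ (x + a * t) * u
  factor = solve-∀

Mod-weaken : ∀ {d n x y} → d ∣ n → Mod n x y → Mod d x y
Mod-weaken {d} {x = x} {y} (divides k refl) (a , b , e) = a * k , b * k ,
  trans (cong (x +_) (*-assoc a k d)) (trans e (cong (y +_) (sym (*-assoc b k d))))

Mod-multiple : ∀ {n} k → Mod n (k * n) 0
Mod-multiple k = 0 , k , +-identityʳ _

Mod-0⇒∣ : ∀ {n x} → Mod n x 0 → n ∣ x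
Mod-0⇒∣ {n} {x} (a , b , e) =
  ∣m+n∣m⇒∣n (subst (n ∣_) (sym (trans (+-comm (a * n) x) e)) (n∣m*n b)) (n∣m*n a)

∣⇒Mod-0 : ∀ {n x} → n ∣ x → Mod n x 0
∣⇒Mod-0 (divides k refl) = Mod-multiple k

Mod-% : ∀ {n} x .{{_ : NonZero n}} → Mod n (x % n) x
Mod-% {n} x = x / n , 0 , trans (sym (m≡m%n+[m/n]*n x n)) (sym (+-identityʳ x))

[m%n+k]%n≡[m+k]%n : ∀ m k n .{{_ : NonZero n}} → (m % n + k) % n ≡ (m + k) % n
[m%n+k]%n≡[m+k]%n m k n = begin
  (m % n + k) % n          ≡⟨ %-distribˡ-+ (m % n) k n ⟩
  (m % n % n + k % n) % n  ≡⟨ cong (λ x → (x + k % n) % n) (m%n%n≡m%n m n) ⟩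
  (m % n + k % n) % n      ≡⟨ sym (%-distribˡ-+ m k n) ⟩
  (m + k) % n              ∎
  where open ≡-Reasoning

x≡1[x∸1] : ∀ {x} → 1 ≤ x → Mod (x ∸ 1) x 1
x≡1[x∸1] {x} x≥1 = 0 , 1 , trans (+-identityʳ x) (trans (sym (m+[n∸m]≡n x≥1)) (cong (1 +_) (sym (+-identityʳ _))))

Mod⇒≡-below : ∀ {n x y} .{{_ : NonZero n}} → x < n → y < n → Mod n x y → x ≡ y
Mod⇒≡-below {n} {x} {y} x<n y<n (a , b , e) = begin
  x                ≡⟨ sym (m<n⇒m%n≡m x<n) ⟩
  x % n            ≡⟨ sym ([m+kn]%n≡m%n x a n) ⟩
  (x + a * n) % n  ≡⟨ cong (_% n) e ⟩
  (y + b * n) % n  ≡⟨ [m+kn]%n≡m%n y b n ⟩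
  y % n            ≡⟨ m<n⇒m%n≡m y<n ⟩
  y                ∎
  where open ≡-Reasoning

Mod-inverse : ∀ v Q → Coprime v Q → ∃ λ w → Mod Q (w * v) 1
Mod-inverse v Q c with coprime-Bézout c
... | Bézout.Identity.+- x y eq = x , 0 , y , trans (+-identityʳ _) (sym eq)
Mod-inverse v zero c | Bézout.Identity.-+ x y eq with trans eq (*-zeroʳ y)
... | ()
Mod-inverse v (suc p) c | Bézout.Identity.-+ x y eq = x * p ,
  Mod-+-cancelʳ p (Mod-trans (Mod-reflexive multiple) (Mod-trans (Mod-multiple (p * y)) (Mod-sym 1+p≡0)))
  where
  open ≡-Reasoning
  1+p≡0 : Mod (suc p) (1 + p) 0
  1+p≡0 = 0 , 1 , trans (+-identityʳ _) (sym (+-identityʳ _))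
  -- 1 + x v = y (1 + p), so x p ≡ -x is an inverse of v.
  multiple : x * p * v + p ≡ p * y * suc p
  multiple = begin
    x * p * v + p    ≡⟨ regroup x p v ⟩
    p * (1 + x * v)  ≡⟨ cong (p *_) eq ⟩
    p * (y * suc p)  ≡⟨ sym (*-assoc p y (suc p)) ⟩
    p * y * suc p    ∎
    where
    regroup : ∀ x p v → x * p * v + p ≡ p * (1 + x * v)
    regroup = solve-∀

multiple-of-unit : ∀ {t} .{{_ : NonZero t}} w v → Mod t (w * v) 1 → ∀ j → ∃ λ k → k < t × Mod t (k * v) j
multiple-of-unit {t} w v wv≡1 j = (j * w) % t , m%n<n (j * w) t , (begin
  (j * w) % t * v  ≈⟨ Mod-*ʳ v (Mod-% (j * w)) ⟩
  j * w * v        ≡⟨ *-assoc j w v ⟩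
  j * (w * v)      ≈⟨ Mod-*ˡ j wv≡1 ⟩
  j * 1            ≡⟨ *-identityʳ j ⟩
  j                ∎)
  where open ModReasoning t

-- Boolean predicates as propositions

≢true⇒≡false : ∀ {b} → b ≢ true → b ≡ false
≢true⇒≡false = ¬-not

not-true⇒≢true : ∀ {b} → not b ≡ true → b ≢ true
not-true⇒≢true {true} () refl

≢true⇒not-true : ∀ {b} → b ≢ true → not b ≡ true
≢true⇒not-true b≢true = cong not (≢true⇒≡false b≢true)

∧-intro : ∀ {a b} → a ≡ true → b ≡ true → a ∧ b ≡ true
∧-intro refl refl = refl

anyBelow⇒∃ : ∀ n P → anyBelow n P ≡ true → ∃ λ k → k < n × P k ≡ true
anyBelow⇒∃ (suc n) P any with P n in Pn
... | true  = n , ≤-refl , Pn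
... | false with anyBelow⇒∃ n P any
...   | k , k<n , Pk = k , m≤n⇒m≤1+n k<n , Pk

∃⇒anyBelow : ∀ n P k → k < n → P k ≡ true → anyBelow n P ≡ true
∃⇒anyBelow (suc n) P k k<1+n Pk with m<1+n⇒m<n∨m≡n k<1+n
... | inj₂ refl = cong (_∨ anyBelow n P) Pk
... | inj₁ k<n with P n
...   | true  = refl
...   | false = ∃⇒anyBelow n P k k<n Pk

allBelow⇒∀ : ∀ n P → allBelow n P ≡ true → ∀ k → k < n → P k ≡ true
allBelow⇒∀ (suc n) P all k k<1+n with m<1+n⇒m<n∨m≡n k<1+n
... | inj₁ k<n  = allBelow⇒∀ n P (∧-conicalʳ (P n) _ all) k k<n
... | inj₂ refl = ∧-conicalˡ _ _ all

∀⇒allBelow : ∀ n P → (∀ k → k < n → P k ≡ true) → allBelow n P ≡ true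
∀⇒allBelow zero    P _ = refl
∀⇒allBelow (suc n) P f = ∧-intro (f n ≤-refl) (∀⇒allBelow n P (λ k k<n → f k (m≤n⇒m≤1+n k<n)))

anyBelow-cong : ∀ n {P Q} → (∀ k → P k ≡ Q k) → anyBelow n P ≡ anyBelow n Q
anyBelow-cong zero    _   = refl
anyBelow-cong (suc n) P≡Q = cong₂ _∨_ (P≡Q n) (anyBelow-cong n P≡Q)

allBelow-cong : ∀ n {P Q} → (∀ k → P k ≡ Q k) → allBelow n P ≡ allBelow n Q
allBelow-cong zero    _   = refl
allBelow-cong (suc n) P≡Q = cong₂ _∧_ (P≡Q n) (allBelow-cong n P≡Q)

allFinᵇ⇒∀ : ∀ {m} (P : Fin m → Bool) → allFinᵇ P ≡ true → ∀ i → P i ≡ true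
allFinᵇ⇒∀ P all i = go (allFin _) all (∈-allFin⁺ i)
  where
  go : ∀ {k} (is : Vec (Fin _) k) → Vec.foldr _ _∧_ true (Vec.map P is) ≡ true → i ∈ is → P i ≡ true
  go (j ∷ is) all (here refl) = ∧-conicalˡ _ _ all
  go (j ∷ is) all (there i∈is) = go is (∧-conicalʳ (P j) _ all) i∈is

allFinᵇ-cong : ∀ {m} {P Q : Fin m → Bool} → (∀ i → P i ≡ Q i) → allFinᵇ P ≡ allFinᵇ Q
allFinᵇ-cong P≡Q = cong (Vec.foldr _ _∧_ true) (Vec.map-cong P≡Q (allFin _))

congᵇ⇒Mod : ∀ N x y → congᵇ N x y ≡ true → Mod N x y
congᵇ⇒Mod N x y _ with N ∣? ∣ x - y ∣ | ≤-total x y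
... | yes (divides c eq) | inj₁ x≤y = c , 0 , (begin
  x + c * N      ≡⟨ cong (x +_) (trans (sym eq) (m≤n⇒∣m-n∣≡n∸m x≤y)) ⟩
  x + (y ∸ x)    ≡⟨ m+[n∸m]≡n x≤y ⟩
  y              ≡⟨ sym (+-identityʳ y) ⟩
  y + 0 * N      ∎)
  where open ≡-Reasoning
... | yes (divides c eq) | inj₂ y≤x = 0 , c , (begin
  x + 0 * N      ≡⟨ +-identityʳ x ⟩
  x              ≡⟨ sym (m+[n∸m]≡n y≤x) ⟩
  y + (x ∸ y)    ≡⟨ cong (y +_) (trans (sym (m≤n⇒∣n-m∣≡n∸m y≤x)) eq) ⟩
  y + c * N      ∎)
  where open ≡-Reasoning

Mod⇒congᵇ : ∀ N x y → Mod N x y → congᵇ N x y ≡ true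
Mod⇒congᵇ N x y x≡y with N ∣? ∣ x - y ∣
... | yes _  = refl
... | no N∤ = ⊥-elim (N∤ (divides-distance (≤-total x y)))
  where
  divides-distance : (x ≤ y) ⊎ (y ≤ x) → N ∣ ∣ x - y ∣
  divides-distance (inj₁ x≤y) = subst (N ∣_) (sym (m≤n⇒∣m-n∣≡n∸m x≤y))
    (Mod-0⇒∣ (Mod-+-cancelʳ x (subst (λ w → Mod N w (0 + x)) (sym (m∸n+n≡m x≤y)) (Mod-sym x≡y))))
  divides-distance (inj₂ y≤x) = subst (N ∣_) (sym (m≤n⇒∣n-m∣≡n∸m y≤x))
    (Mod-0⇒∣ (Mod-+-cancelʳ y (subst (λ w → Mod N w (0 + y)) (sym (m∸n+n≡m y≤x)) x≡y)))

congᵇ-cong : ∀ N {x y x′ y′} → Mod N x y ⇔ Mod N x′ y′ → congᵇ N x y ≡ congᵇ N x′ y′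
congᵇ-cong N x≡y⇔x′≡y′ = ⇔→≡ (mk⇔
  (λ c → Mod⇒congᵇ N _ _ (Equivalence.to x≡y⇔x′≡y′ (congᵇ⇒Mod N _ _ c)))
  (λ c → Mod⇒congᵇ N _ _ (Equivalence.from x≡y⇔x′≡y′ (congᵇ⇒Mod N _ _ c))))

∧-cong-ifˡ : ∀ {a a′ b b′} → a ≡ a′ → (a′ ≡ true → b ≡ b′) → a ∧ b ≡ a′ ∧ b′
∧-cong-ifˡ {a′ = false} refl _      = refl
∧-cong-ifˡ {a′ = true}  refl b≡b′  = b≡b′ refl

∧-cong-ifʳ : ∀ {a a′ b b′} → b ≡ b′ → (b′ ≡ true → a ≡ a′) → a ∧ b ≡ a′ ∧ b′
∧-cong-ifʳ {a} {a′} {b′ = false} refl _     = trans (∧-zeroʳ a) (sym (∧-zeroʳ a′))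
∧-cong-ifʳ          {b′ = true}  refl a≡a′ = cong (_∧ true) (a≡a′ refl)

selectedSum : ∀ {m} → Vec Bool m → Vec ℕ m → ℕ
selectedSum bs lam = sum (Vec.zipWith (λ b l → if b then l else 0) bs lam)

lookup≤selectedSum : ∀ {m} (bs : Vec Bool m) (lam : Vec ℕ m) i → lookup bs i ≡ true → lookup lam i ≤ selectedSum bs lam
lookup≤selectedSum (true  ∷ bs) (l ∷ lam) fzero    _   = m≤m+n l _
lookup≤selectedSum (true  ∷ bs) (l ∷ lam) (fsuc i) bᵢ = ≤-trans (lookup≤selectedSum bs lam i bᵢ) (m≤n+m _ l)
lookup≤selectedSum (false ∷ bs) (l ∷ lam) (fsuc i) bᵢ = lookup≤selectedSum bs lam i bᵢ

selectedSum+complement : ∀ {m} (bs : Vec Bool m) (lam : Vec ℕ m) →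
                         selectedSum bs lam + selectedSum (Vec.map not bs) lam ≡ sum lam
selectedSum+complement []           []        = refl
selectedSum+complement (true  ∷ bs) (l ∷ lam) =
  trans (+-assoc l _ _) (cong (l +_) (selectedSum+complement bs lam))
selectedSum+complement (false ∷ bs) (l ∷ lam) =
  trans (+-comm (selectedSum bs lam) (l + _)) (trans (+-assoc l _ _)
    (cong (l +_) (trans (+-comm _ (selectedSum bs lam)) (selectedSum+complement bs lam))))

-- Powers and finite sums in a commutative ring

module PowersAndSums {c ℓ : Level} (K : CommutativeRing c ℓ) where

  module R = CommutativeRing K
  open R using (Carrier; _≈_; 0#; 1#; setoid) renaming (_+_ to _+ᴷ_; _*_ to _*ᴷ_)
  open import Relation.Binary.Reasoning.Setoid setoid
  open import Algebra.Properties.CommutativeSemiring.Exp R.commutativeSemiring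
    using (^-congˡ; ^-homo-*; ^-assocʳ; ^-distrib-*) renaming (_^_ to _^ᴷ_)
  open import Algebra.Properties.Monoid.Mult R.*-monoid using (×-idem)
  open import Algebra.Properties.Ring R.ring using (-‿distribʳ-*)
  open import Algebra.Properties.Group R.+-group using (x∙y⁻¹≈ε⇒x≈y)

  pow≡^ : ∀ x n → pow K x n ≡ x ^ᴷ n
  pow≡^ x zero    = refl
  pow≡^ x (suc n) = cong (x *ᴷ_) (pow≡^ x n)

  pow-congˡ : ∀ n {x y} → x ≈ y → pow K x n ≈ pow K y n
  pow-congˡ n {x} {y} rewrite pow≡^ x n | pow≡^ y n = ^-congˡ n

  pow-homo-* : ∀ x m n → pow K x (m ℕ.+ n) ≈ pow K x m *ᴷ pow K x n
  pow-homo-* x m n rewrite pow≡^ x (m ℕ.+ n) | pow≡^ x m | pow≡^ x n = ^-homo-* x m n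

  pow-assocʳ : ∀ x m n → pow K x (m ℕ.* n) ≈ pow K (pow K x m) n
  pow-assocʳ x m n rewrite pow≡^ x (m ℕ.* n) | pow≡^ (pow K x m) n | pow≡^ x m = R.sym (^-assocʳ x m n)

  pow-distrib-* : ∀ x y n → pow K (x *ᴷ y) n ≈ pow K x n *ᴷ pow K y n
  pow-distrib-* x y n rewrite pow≡^ (x *ᴷ y) n | pow≡^ x n | pow≡^ y n = ^-distrib-* x y n

  pow-1 : ∀ n → pow K 1# n ≈ 1#
  pow-1 zero    = R.refl
  pow-1 (suc n) rewrite pow≡^ 1# n = ×-idem (R.*-identityˡ 1#) (suc n)

  ∣⇒pow≈1 : ∀ {x} n {m} → pow K x n ≈ 1# → n ∣ m → pow K x m ≈ 1#
  ∣⇒pow≈1 {x} n xⁿ≈1 (divides k refl) = begin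
    pow K x (k ℕ.* n)       ≡⟨ cong (pow K x) (ℕ.*-comm k n) ⟩
    pow K x (n ℕ.* k)       ≈⟨ pow-assocʳ x n k ⟩
    pow K (pow K x n) k     ≈⟨ pow-congˡ k xⁿ≈1 ⟩
    pow K 1# k              ≈⟨ pow-1 k ⟩
    1#                      ∎

  primitiveRoot⇒∣ : ∀ {ω N} .{{_ : ℕ.NonZero N}} → PrimitiveRoot K ω N → ∀ X → pow K ω X ≈ 1# → N ∣ X
  primitiveRoot⇒∣ {ω} {N} (ωᴺ≈1 , ω-primitive) X ωˣ≈1 = m%n≡0⇒n∣m X N (remainder≡0 (X % N) refl)
    where
    ω^[X%N]≈1 : pow K ω (X % N) ≈ 1#
    ω^[X%N]≈1 = begin
      pow K ω (X % N)                              ≈⟨ R.*-identityʳ _ ⟨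
      pow K ω (X % N) *ᴷ 1#                         ≈⟨ R.*-cong R.refl (∣⇒pow≈1 N ωᴺ≈1 (m∣m*n (X / N))) ⟨
      pow K ω (X % N) *ᴷ pow K ω (N ℕ.* (X / N))    ≈⟨ pow-homo-* ω (X % N) (N ℕ.* (X / N)) ⟨
      pow K ω (X % N ℕ.+ N ℕ.* (X / N))            ≡⟨ cong (λ w → pow K ω (X % N ℕ.+ w)) (ℕ.*-comm N (X / N)) ⟩
      pow K ω (X % N ℕ.+ X / N ℕ.* N)              ≡⟨ cong (pow K ω) (m≡m%n+[m/n]*n X N) ⟨
      pow K ω X                                    ≈⟨ ωˣ≈1 ⟩
      1#                                           ∎
    remainder≡0 : ∀ r → r ≡ X % N → X % N ≡ 0
    remainder≡0 zero    r≡ = sym r≡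
    remainder≡0 (suc r) r≡ = ⊥-elim (ω-primitive (suc r) z<s (subst (ℕ._< N) (sym r≡) (m%n<n X N))
                                       (subst (λ w → pow K ω w ≈ 1#) (sym r≡) ω^[X%N]≈1))

  -- x (1 - η) = 0 and K has no zero divisors.
  x≈x*η⇒x≈0 : (∀ x y → x *ᴷ y ≈ 0# → x ≈ 0# ⊎ y ≈ 0#) →
              ∀ x η → x ≈ x *ᴷ η → ¬ (η ≈ 1#) → x ≈ 0#
  x≈x*η⇒x≈0 domain x η x≈xη η≉1 with domain x (1# R.- η) x[1-η]≈0
    where
    x[1-η]≈0 : x *ᴷ (1# R.- η) ≈ 0#
    x[1-η]≈0 = begin
      x *ᴷ (1# R.- η)              ≈⟨ R.distribˡ x 1# (R.- η) ⟩
      x *ᴷ 1# +ᴷ x *ᴷ (R.- η)      ≈⟨ R.+-cong (R.*-identityʳ x) (R.sym (-‿distribʳ-* x η)) ⟩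
      x R.- x *ᴷ η                 ≈⟨ R.+-cong R.refl (R.-‿cong x≈xη) ⟨
      x R.- x                      ≈⟨ R.-‿inverseʳ x ⟩
      0#                           ∎
  ... | inj₁ x≈0   = x≈0
  ... | inj₂ 1-η≈0 = ⊥-elim (η≉1 (R.sym (x∙y⁻¹≈ε⇒x≈y 1# η 1-η≈0)))

  sumMap : {A : Set} → (A → Carrier) → List A → Carrier
  sumMap F = foldr (λ a acc → F a +ᴷ acc) 0#

  sumMap-cong : {A : Set} {F G : A → Carrier} (xs : List A) → (∀ a → F a ≈ G a) → sumMap F xs ≈ sumMap G xs
  sumMap-cong []       F≈G = R.refl
  sumMap-cong (x ∷ xs) F≈G = R.+-cong (F≈G x) (sumMap-cong xs F≈G)

  sumMap-++ : {A : Set} (F : A → Carrier) (xs ys : List A) → sumMap F (xs ++ ys) ≈ sumMap F xs +ᴷ sumMap F ys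
  sumMap-++ F []       ys = R.sym (R.+-identityˡ _)
  sumMap-++ F (x ∷ xs) ys = R.trans (R.+-cong R.refl (sumMap-++ F xs ys)) (R.sym (R.+-assoc _ _ _))

  sumMap-map : {A B : Set} (F : B → Carrier) (h : A → B) (xs : List A) → sumMap F (map h xs) ≈ sumMap (λ a → F (h a)) xs
  sumMap-map F h []       = R.refl
  sumMap-map F h (x ∷ xs) = R.+-cong R.refl (sumMap-map F h xs)

  sumMap-concatMap : {A B : Set} (F : B → Carrier) (g : A → List B) (xs : List A) →
                     sumMap F (concatMap g xs) ≈ sumMap (λ a → sumMap F (g a)) xs
  sumMap-concatMap F g []       = R.refl
  sumMap-concatMap F g (x ∷ xs) = R.trans (sumMap-++ F (g x) (concatMap g xs)) (R.+-cong R.refl (sumMap-concatMap F g xs))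

  sumMap-*ʳ : {A : Set} (η : Carrier) (F : A → Carrier) (xs : List A) → sumMap (λ a → F a *ᴷ η) xs ≈ sumMap F xs *ᴷ η
  sumMap-*ʳ η F []       = R.sym (R.zeroˡ η)
  sumMap-*ʳ η F (x ∷ xs) = R.trans (R.+-cong R.refl (sumMap-*ʳ η F xs)) (R.sym (R.distribʳ η _ _))

  sumMap-applyUpTo-cong : ∀ {G H : ℕ → Carrier} {f g : ℕ → ℕ} n → (∀ i → i ℕ.< n → G (f i) ≈ H (g i)) →
                          sumMap G (applyUpTo f n) ≈ sumMap H (applyUpTo g n)
  sumMap-applyUpTo-cong zero    _   = R.refl
  sumMap-applyUpTo-cong (suc n) G≈H =
    R.+-cong (G≈H 0 z<s) (sumMap-applyUpTo-cong n λ i i<n → G≈H (suc i) (s<s i<n))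

  sumMap-applyUpTo-+ : ∀ (G : ℕ → Carrier) (f : ℕ → ℕ) m n →
    sumMap G (applyUpTo f (m ℕ.+ n)) ≈ sumMap G (applyUpTo f m) +ᴷ sumMap G (applyUpTo (λ i → f (m ℕ.+ i)) n)
  sumMap-applyUpTo-+ G f zero    n = R.sym (R.+-identityˡ _)
  sumMap-applyUpTo-+ G f (suc m) n =
    R.trans (R.+-cong R.refl (sumMap-applyUpTo-+ G (λ i → f (suc i)) m n)) (R.sym (R.+-assoc _ _ _))

  sumMap-applyUpTo-last : ∀ (G : ℕ → Carrier) (f : ℕ → ℕ) n →
    sumMap G (applyUpTo f (suc n)) ≈ sumMap G (applyUpTo f n) +ᴷ G (f n)
  sumMap-applyUpTo-last G f n = begin
    sumMap G (applyUpTo f (suc n))         ≡⟨ cong (λ k → sumMap G (applyUpTo f k)) (ℕ.+-comm 1 n) ⟩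
    sumMap G (applyUpTo f (n ℕ.+ 1))       ≈⟨ sumMap-applyUpTo-+ G f n 1 ⟩
    sumMap G (applyUpTo f n) +ᴷ (G (f (n ℕ.+ 0)) +ᴷ 0#) ≈⟨ R.+-cong R.refl (R.+-identityʳ _) ⟩
    sumMap G (applyUpTo f n) +ᴷ G (f (n ℕ.+ 0)) ≡⟨ cong (λ k → sumMap G (applyUpTo f n) +ᴷ G (f k)) (ℕ.+-identityʳ n) ⟩
    sumMap G (applyUpTo f n) +ᴷ G (f n)     ∎

  module Rotation (u : ℕ) .{{_ : ℕ.NonZero u}} where

    sumMap-rotate₁ : ∀ (G : ℕ → Carrier) → sumMap G (applyUpTo (λ i → suc i % u) u) ≈ sumMap G (upTo u)
    sumMap-rotate₁ G = go u refl
      where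
      -- induction on the length, keeping the modulus u fixed
      go : ∀ n → n ≡ u → sumMap G (applyUpTo (λ i → suc i % u) n) ≈ sumMap G (upTo n)
      go zero    _   = R.refl
      go (suc n) n+1≡u = begin
        sumMap G (applyUpTo (λ i → suc i % u) (suc n))           ≈⟨ sumMap-applyUpTo-last G (λ i → suc i % u) n ⟩
        sumMap G (applyUpTo (λ i → suc i % u) n) +ᴷ G (suc n % u) ≈⟨ R.+-cong
          (sumMap-applyUpTo-cong n λ i i<n → R.reflexive (cong G (m<n⇒m%n≡m (subst (suc i ℕ.<_) n+1≡u (s<s i<n)))))
          (R.reflexive (cong G (trans (cong (_% u) n+1≡u) (n%n≡0 u)))) ⟩
        sumMap G (applyUpTo suc n) +ᴷ G 0                         ≈⟨ R.+-comm _ _ ⟩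
        sumMap G (upTo (suc n))                                  ∎

    sumMap-rotate : ∀ c (G : ℕ → Carrier) → sumMap G (applyUpTo (λ i → (i ℕ.+ c) % u) u) ≈ sumMap G (upTo u)
    sumMap-rotate zero    G = sumMap-applyUpTo-cong u λ i i<u →
      R.reflexive (cong G (trans (cong (_% u) (ℕ.+-identityʳ i)) (m<n⇒m%n≡m i<u)))
    sumMap-rotate (suc c) G = begin
      sumMap G (applyUpTo (λ i → (i ℕ.+ suc c) % u) u)  ≈⟨ sumMap-applyUpTo-cong u (λ i _ → R.reflexive (cong G (shift i))) ⟩
      sumMap G′ (applyUpTo (λ i → suc i % u) u)         ≈⟨ sumMap-rotate₁ G′ ⟩
      sumMap G′ (upTo u)                                ≈⟨ sumMap-applyUpTo-cong u (λ _ _ → R.refl) ⟩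
      sumMap G (applyUpTo (λ i → (i ℕ.+ c) % u) u)      ≈⟨ sumMap-rotate c G ⟩
      sumMap G (upTo u)                                 ∎
      where
      G′ : ℕ → Carrier
      G′ j = G ((j ℕ.+ c) % u)
      shift : ∀ i → (i ℕ.+ suc c) % u ≡ (suc i % u ℕ.+ c) % u
      shift i = trans (cong (_% u) (ℕ.+-suc i c)) (sym ([m%n+k]%n≡[m+k]%n (suc i) c u))

-- A character is its exponent modulo N = q^D - 1.  Composition with the
-- norm multiplies exponents by M = (q^D - 1)/(q - 1), so δ^s has exponent
-- h₀ = s M v; as v is invertible modulo t, ⟨h₀⟩ = ⟨u⟩ for u = s M, and the
-- classes of Γ_D/⟨δ^s⟩ are the residues modulo u.
module Classes (q D M s t v : ℕ) (q≥2 : 2 ≤ q) (D≥1 : 1 ≤ D)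
  (M[q∸1]≡N : M * (q ∸ 1) ≡ q ^ D ∸ 1) (st≡q∸1 : s * t ≡ q ∸ 1) (v⊥q∸1 : Coprime v (q ∸ 1)) where

  N u h₀ : ℕ
  N  = q ^ D ∸ 1
  u  = s * M
  h₀ = s * (M * v)

  q≥1 : 1 ≤ q
  q≥1 = <-trans z<s q≥2

  q^D≥2 : 2 ≤ q ^ D
  q^D≥2 = ≤-trans q≥2 (subst (_≤ q ^ D) (*-identityʳ q) (^-monoʳ-≤ q {{>-nonZero q≥1}} D≥1))

  N≢0 : N ≢ 0
  N≢0 N≡0 = <⇒≱ q^D≥2 (m∸n≡0⇒m≤n N≡0)

  N≡t*u : N ≡ t * u
  N≡t*u = begin
    N              ≡⟨ sym M[q∸1]≡N ⟩
    M * (q ∸ 1)    ≡⟨ cong (M *_) (sym st≡q∸1) ⟩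
    M * (s * t)    ≡⟨ regroup M s t ⟩
    t * (s * M)    ∎
    where
    open ≡-Reasoning
    regroup : ∀ M s t → M * (s * t) ≡ t * (s * M)
    regroup = solve-∀

  h₀≡v*u : h₀ ≡ v * u
  h₀≡v*u = regroup s M v
    where
    regroup : ∀ s M v → s * (M * v) ≡ v * (s * M)
    regroup = solve-∀

  instance
    N-nonZero : NonZero N
    N-nonZero = ≢-nonZero N≢0
    u-nonZero : NonZero u
    u-nonZero = ≢-nonZero (λ u≡0 → N≢0 (trans N≡t*u (trans (cong (t *_) u≡0) (*-zeroʳ t))))
    t-nonZero : NonZero t
    t-nonZero = ≢-nonZero (λ t≡0 → N≢0 (trans N≡t*u (cong (_* u) t≡0)))

  u∣N : u ∣ N
  u∣N = divides t N≡t*u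

  t∣q∸1 : t ∣ q ∸ 1
  t∣q∸1 = divides s (sym st≡q∸1)

  u≤N : u ≤ N
  u≤N = ∣⇒≤ u∣N

  t≤N : t ≤ N
  t≤N = ∣⇒≤ (divides u (trans N≡t*u (*-comm t u)))

  Mod-N⇒u : ∀ {x y} → Mod N x y → Mod u x y
  Mod-N⇒u = Mod-weaken u∣N

  Mod-t*u⇒N : ∀ {x y} → Mod (t * u) x y → Mod N x y
  Mod-t*u⇒N {x} {y} = subst (λ n → Mod n x y) (sym N≡t*u)

  q^e≡1[q∸1] : ∀ e → Mod (q ∸ 1) (q ^ e) 1
  q^e≡1[q∸1] e = subst (Mod (q ∸ 1) (q ^ e)) (^-zeroˡ e) (Mod-^ e (x≡1[x∸1] q≥1))

  q^e≡1[t] : ∀ e → Mod t (q ^ e) 1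
  q^e≡1[t] e = Mod-weaken t∣q∸1 (q^e≡1[q∸1] e)

  q^D≡1 : Mod N (q ^ D) 1
  q^D≡1 = x≡1[x∸1] (<-trans z<s q^D≥2)

  FrobFixed : ℕ → ℕ → Set
  FrobFixed e x = Mod N (q ^ e * x) x

  frobFixed-M : ∀ e → FrobFixed e M
  frobFixed-M e = subst (λ n → Mod n (q ^ e * M) M) (trans (*-comm (q ∸ 1) M) M[q∸1]≡N)
    (subst (Mod ((q ∸ 1) * M) (q ^ e * M)) (*-identityˡ M) (Mod-scale M (q^e≡1[q∸1] e)))

  frobFixed-multiple : ∀ e j → FrobFixed e (j * u)
  frobFixed-multiple e j = Mod-t*u⇒N
    (subst₂ (Mod (t * u)) (swap (q ^ e) j u) (cong (j *_) (*-identityˡ u)) (Mod-*ˡ j (Mod-scale u (q^e≡1[t] e))))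
    where
    swap : ∀ a j u → j * (a * u) ≡ a * (j * u)
    swap = solve-∀

  frobFixed-+ : ∀ e {x y} → FrobFixed e x → FrobFixed e y → FrobFixed e (x + y)
  frobFixed-+ e {x} {y} fx fy = Mod-trans (Mod-reflexive (*-distribˡ-+ (q ^ e) x y)) (Mod-+ fx fy)

  frobFixed-+-cancelʳ : ∀ e {x y} → FrobFixed e y → FrobFixed e (x + y) → FrobFixed e x
  frobFixed-+-cancelʳ e {x} {y} fy fxy = Mod-+-cancelʳ y (Mod-trans (Mod-+ Mod-refl (Mod-sym fy))
    (Mod-trans (Mod-reflexive (sym (*-distribˡ-+ (q ^ e) x y))) fxy))

  frobFixed-Mod-u : ∀ e {x y} → Mod u x y → FrobFixed e x → FrobFixed e y
  frobFixed-Mod-u e (a , b , eq) fx =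
    frobFixed-+-cancelʳ e (frobFixed-multiple e b) (subst (FrobFixed e) eq (frobFixed-+ e fx (frobFixed-multiple e a)))

  frobFixed-Mod-u⇔ : ∀ e {x y} → Mod u x y → FrobFixed e x ⇔ FrobFixed e y
  frobFixed-Mod-u⇔ e x≡y = mk⇔ (frobFixed-Mod-u e x≡y) (frobFixed-Mod-u e (Mod-sym x≡y))

  frobFixed-+M⇔ : ∀ e {x} → FrobFixed e x ⇔ FrobFixed e (x + M)
  frobFixed-+M⇔ e = mk⇔ (λ fx → frobFixed-+ e fx (frobFixed-M e)) (frobFixed-+-cancelʳ e (frobFixed-M e))

  -- q^D ≡ 1 (mod N), so multiplication by q^((D - 1) j) undoes Frob^j.
  frob-inverse : ∀ j x → Mod N (q ^ ((D ∸ 1) * j) * (q ^ j * x)) x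
  frob-inverse j x = begin
    q ^ ((D ∸ 1) * j) * (q ^ j * x)  ≡⟨ sym (*-assoc (q ^ ((D ∸ 1) * j)) (q ^ j) x) ⟩
    q ^ ((D ∸ 1) * j) * q ^ j * x    ≡⟨ cong (_* x) q^[Dj] ⟩
    q ^ (D * j) * x                  ≈⟨ Mod-*ʳ x q^Dj≡1 ⟩
    1 * x                            ≡⟨ *-identityˡ x ⟩
    x                                ∎
    where
    open ModReasoning N
    q^[Dj] : q ^ ((D ∸ 1) * j) * q ^ j ≡ q ^ (D * j)
    q^[Dj] = trans (sym (^-distribˡ-+-* q ((D ∸ 1) * j) j))
      (cong (q ^_) (trans (+-comm ((D ∸ 1) * j) j) (cong (_* j) (m+[n∸m]≡n D≥1))))
    q^Dj≡1 : Mod N (q ^ (D * j)) 1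
    q^Dj≡1 = subst₂ (Mod N) (^-*-assoc q D j) (^-zeroˡ j) (Mod-^ j q^D≡1)

  frobFixed-frob⇔ : ∀ e j {x} → FrobFixed e x ⇔ FrobFixed e (q ^ j * x)
  frobFixed-frob⇔ e j {x} = mk⇔ to from
    where
    open ModReasoning N
    P : ℕ
    P = q ^ ((D ∸ 1) * j)
    commute : ∀ a b x → a * (b * x) ≡ b * (a * x)
    commute = solve-∀
    to : FrobFixed e x → FrobFixed e (q ^ j * x)
    to fx = begin
      q ^ e * (q ^ j * x)  ≡⟨ commute (q ^ e) (q ^ j) x ⟩
      q ^ j * (q ^ e * x)  ≈⟨ Mod-*ˡ (q ^ j) fx ⟩
      q ^ j * x            ∎
    from : FrobFixed e (q ^ j * x) → FrobFixed e x
    from f = begin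
      q ^ e * x                  ≈⟨ Mod-sym (frob-inverse j (q ^ e * x)) ⟩
      P * (q ^ j * (q ^ e * x))  ≡⟨ cong (P *_) (commute (q ^ j) (q ^ e) x) ⟩
      P * (q ^ e * (q ^ j * x))  ≈⟨ Mod-*ˡ P f ⟩
      P * (q ^ j * x)            ≈⟨ frob-inverse j x ⟩
      x                          ∎

  -- The character of exponent u (δ^s up to a unit) is trivial at ζ_n^t̂ = g^(z t̂).
  N∣u*[z*t̂] : ∀ {n z t̂} .{{_ : NonZero n}} → n ∣ q ∸ 1 → N ∣ n * z → t ∣ M * t̂ → N ∣ u * (z * t̂)
  N∣u*[z*t̂] {n} {z} {t̂} (divides c q∸1≡c*n) N∣nz t∣Mt̂ =
    subst (_∣ u * (z * t̂)) (trans (*-comm u t) (sym N≡t*u)) (*-monoʳ-∣ u (∣-trans t∣Mt̂ (*-monoˡ-∣ t̂ M∣z)))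
    where
    regroup : ∀ M c n → M * (c * n) ≡ n * (M * c)
    regroup = solve-∀
    N≡n*[M*c] : N ≡ n * (M * c)
    N≡n*[M*c] = trans (sym M[q∸1]≡N) (trans (cong (M *_) q∸1≡c*n) (regroup M c n))
    M∣z : M ∣ z
    M∣z = ∣-trans (m∣m*n c) (*-cancelˡ-∣ n (subst (_∣ n * z) N≡n*[M*c] N∣nz))

  sameClassᵇ⇒Mod : ∀ x y → sameClassᵇ N h₀ x y ≡ true → Mod u x y
  sameClassᵇ⇒Mod x y same with anyBelow⇒∃ N _ same
  ... | k , _ , x+kh₀≡y = begin
    x           ≡⟨ sym (+-identityʳ x) ⟩
    x + 0       ≈⟨ Mod-+ (Mod-refl {x = x}) (Mod-sym kh₀≡0) ⟩
    x + k * h₀  ≈⟨ Mod-N⇒u (congᵇ⇒Mod N _ _ x+kh₀≡y) ⟩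
    y           ∎
    where
    open ModReasoning u
    kh₀≡0 : Mod u (k * h₀) 0
    kh₀≡0 = subst (λ w → Mod u w 0) (trans (*-assoc k v u) (cong (k *_) (sym h₀≡v*u))) (Mod-multiple (k * v))

  Mod-u⇒Mod-N : ∀ {x y} → Mod u x y → ∃ λ j → Mod N (x + j * u) y
  Mod-u⇒Mod-N {x} {y} (a , b , x+au≡y+bu) = a + b * pred t , 0 , b , (begin
    x + (a + b * pred t) * u + 0 * N  ≡⟨ regroup x a b (pred t) u N ⟩
    (x + a * u) + b * pred t * u      ≡⟨ cong (_+ b * pred t * u) x+au≡y+bu ⟩
    (y + b * u) + b * pred t * u      ≡⟨ regroup′ y b (pred t) u ⟩
    y + b * (suc (pred t) * u)        ≡⟨ cong (λ w → y + b * (w * u)) (suc-pred t) ⟩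
    y + b * (t * u)                   ≡⟨ cong (λ w → y + b * w) (sym N≡t*u) ⟩
    y + b * N                         ∎)
    where
    open ≡-Reasoning
    regroup : ∀ x a b p u N → x + (a + b * p) * u + 0 * N ≡ (x + a * u) + b * p * u
    regroup = solve-∀
    regroup′ : ∀ y b p u → (y + b * u) + b * p * u ≡ y + b * (suc p * u)
    regroup′ = solve-∀

  multiple-of-h₀ : ∀ j → ∃ λ k → k < N × Mod N (k * h₀) (j * u)
  multiple-of-h₀ j with Mod-inverse v (q ∸ 1) v⊥q∸1
  ... | w , wv≡1 = scale (multiple-of-unit w v (Mod-weaken t∣q∸1 wv≡1) j)
    where
    scale : (∃ λ k → k < t × Mod t (k * v) j) → ∃ λ k → k < N × Mod N (k * h₀) (j * u)
    scale (k , k<t , kv≡j) = k , <-≤-trans k<t t≤N ,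
      Mod-t*u⇒N (subst (λ x → Mod (t * u) x (j * u)) (trans (*-assoc k v u) (cong (k *_) (sym h₀≡v*u))) (Mod-scale u kv≡j))

  Mod⇒sameClassᵇ : ∀ x y → Mod u x y → sameClassᵇ N h₀ x y ≡ true
  Mod⇒sameClassᵇ x y x≡y =
    let (j , x+ju≡y)       = Mod-u⇒Mod-N x≡y
        (k , k<N , kh₀≡ju) = multiple-of-h₀ j
    in ∃⇒anyBelow N _ k k<N (Mod⇒congᵇ N _ _ (Mod-trans (Mod-+ (Mod-refl {x = x}) kh₀≡ju) x+ju≡y))

  sameClassᵇ-cong : ∀ {x y x′ y′} → Mod u x y ⇔ Mod u x′ y′ → sameClassᵇ N h₀ x y ≡ sameClassᵇ N h₀ x′ y′
  sameClassᵇ-cong x≡y⇔x′≡y′ = ⇔→≡ (mk⇔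
    (λ same → Mod⇒sameClassᵇ _ _ (Equivalence.to x≡y⇔x′≡y′ (sameClassᵇ⇒Mod _ _ same)))
    (λ same → Mod⇒sameClassᵇ _ _ (Equivalence.from x≡y⇔x′≡y′ (sameClassᵇ⇒Mod _ _ same))))

  <⇒canonicalᵇ : ∀ b → b < u → canonicalᵇ N h₀ b ≡ true
  <⇒canonicalᵇ b b<u = ∧-intro (Equivalence.to T-≡ (<⇒<ᵇ (<-≤-trans b<u u≤N)))
    (∀⇒allBelow b _ λ y y<b → ≢true⇒not-true λ same →
      <-irrefl (Mod⇒≡-below (<-trans y<b b<u) b<u (sameClassᵇ⇒Mod y b same)) y<b)

  canonicalᵇ⇒< : ∀ b → canonicalᵇ N h₀ b ≡ true → b < u
  canonicalᵇ⇒< b canonical with b <? u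
  ... | yes b<u = b<u
  ... | no  b≮u = ⊥-elim (not-true⇒≢true
          (allBelow⇒∀ b _ (∧-conicalʳ _ _ canonical) (b ∸ u) (∸-monoʳ-< (>-nonZero⁻¹ u) u≤b))
          (Mod⇒sameClassᵇ (b ∸ u) b b∸u≡b))
    where
    u≤b : u ≤ b
    u≤b = ≮⇒≥ b≮u
    b∸u≡b : Mod u (b ∸ u) b
    b∸u≡b = 1 , 0 , trans (cong (b ∸ u +_) (*-identityˡ u)) (trans (m∸n+n≡m u≤b) (sym (+-identityʳ b)))

  degreeIsᵇ-cong : ∀ {a b} → (∀ e → FrobFixed e a ⇔ FrobFixed e b) → ∀ d → degreeIsᵇ N q a d ≡ degreeIsᵇ N q b d
  degreeIsᵇ-cong a⇔b zero    = refl
  degreeIsᵇ-cong a⇔b (suc d) =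
    cong₂ _∧_ (congᵇ-cong N (a⇔b (suc d))) (allBelow-cong d λ e → cong not (congᵇ-cong N (a⇔b (suc e))))

  degreeIsᵇ-unique : ∀ a d d′ → degreeIsᵇ N q a d ≡ true → degreeIsᵇ N q a d′ ≡ true → d ≡ d′
  degreeIsᵇ-unique a (suc d) (suc d′) deg deg′ with <-cmp d d′
  ... | tri≈ _ d≡d′ _ = cong suc d≡d′
  ... | tri< d<d′ _ _ =
    ⊥-elim (not-true⇒≢true (allBelow⇒∀ d′ _ (∧-conicalʳ _ _ deg′) d d<d′) (∧-conicalˡ _ _ deg))
  ... | tri> _ _ d′<d =
    ⊥-elim (not-true⇒≢true (allBelow⇒∀ d _ (∧-conicalʳ _ _ deg) d′ d′<d) (∧-conicalˡ _ _ deg′))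

  sameOrbitᵇ⇒degreeIsᵇ-≡ : ∀ a b → sameOrbitᵇ N h₀ q D a b ≡ true →
                            ∀ d → degreeIsᵇ N q a d ≡ degreeIsᵇ N q b d
  sameOrbitᵇ⇒degreeIsᵇ-≡ a b orbit with anyBelow⇒∃ D _ orbit
  ... | j , _ , same = degreeIsᵇ-cong λ e →
    frobFixed-Mod-u⇔ e (sameClassᵇ⇒Mod _ _ same) ⇔-∘ frobFixed-frob⇔ e j

  degreeIsᵇ-≢⇒sameOrbitᵇ-false : ∀ {x y dx dy} → degreeIsᵇ N q x dx ≡ true → degreeIsᵇ N q y dy ≡ true →
                                  dx ≢ dy → sameOrbitᵇ N h₀ q D x y ≡ false
  degreeIsᵇ-≢⇒sameOrbitᵇ-false {x} {y} {dx} {dy} deg-x deg-y dx≢dy = ≢true⇒≡false λ orbit →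
    dx≢dy (degreeIsᵇ-unique y dx dy (trans (sym (sameOrbitᵇ⇒degreeIsᵇ-≡ x y orbit dx)) deg-x) deg-y)

  -- On canonical representatives σ multiplies the class by the character of
  -- exponent M; other exponents are left alone, so σ permutes {0, …, N - 1}.
  σ : ℕ → ℕ
  σ x = if x <ᵇ u then (x + M) % u else x

  σ-< : ∀ {x} → x < u → σ x ≡ (x + M) % u
  σ-< {x} x<u rewrite Equivalence.to T-≡ (<⇒<ᵇ x<u) = refl

  σ-≮ : ∀ {x} → x ≮ u → σ x ≡ x
  σ-≮ {x} x≮u rewrite ≢true⇒≡false {x <ᵇ u} (λ x<ᵇu → x≮u (<ᵇ⇒< x u (Equivalence.from T-≡ x<ᵇu))) = refl

  σ<u : ∀ {x} → x < u → σ x < u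
  σ<u {x} x<u = subst (_< u) (sym (σ-< x<u)) (m%n<n (x + M) u)

  σ≡+M : ∀ {x} → x < u → Mod u (σ x) (x + M)
  σ≡+M {x} x<u = subst (λ y → Mod u y (x + M)) (sym (σ-< x<u)) (Mod-% (x + M))

  σ+multiple≡+M : ∀ {x} → x < u → σ x + (x + M) / u * u ≡ x + M
  σ+multiple≡+M {x} x<u = trans (cong (_+ (x + M) / u * u) (σ-< x<u)) (sym (m≡m%n+[m/n]*n (x + M) u))

  frob-σ : ∀ e {x} → x < u → Mod u (q ^ e * σ x) (q ^ e * x + M)
  frob-σ e {x} x<u = begin
    q ^ e * σ x        ≈⟨ Mod-*ˡ (q ^ e) (σ≡+M x<u) ⟩
    q ^ e * (x + M)    ≡⟨ *-distribˡ-+ (q ^ e) x M ⟩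
    q ^ e * x + q ^ e * M ≈⟨ Mod-+ (Mod-refl {x = q ^ e * x}) (Mod-N⇒u (frobFixed-M e)) ⟩
    q ^ e * x + M      ∎
    where open ModReasoning u

  canonicalᵇ-σ : ∀ x → canonicalᵇ N h₀ (σ x) ≡ canonicalᵇ N h₀ x
  canonicalᵇ-σ x with x <? u
  ... | yes x<u = trans (<⇒canonicalᵇ (σ x) (σ<u x<u)) (sym (<⇒canonicalᵇ x x<u))
  ... | no  x≮u = cong (canonicalᵇ N h₀) (σ-≮ x≮u)

  degreeIsᵇ-σ : ∀ {x} → x < u → ∀ d → degreeIsᵇ N q (σ x) d ≡ degreeIsᵇ N q x d
  degreeIsᵇ-σ x<u = degreeIsᵇ-cong λ e → ⇔-sym (frobFixed-+M⇔ e) ⇔-∘ frobFixed-Mod-u⇔ e (σ≡+M x<u)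

  sameClassᵇ-+M : ∀ {x x′ y y′} → Mod u x′ (x + M) → Mod u y′ (y + M) →
                  sameClassᵇ N h₀ x′ y′ ≡ sameClassᵇ N h₀ x y
  sameClassᵇ-+M x′≡x+M y′≡y+M = sameClassᵇ-cong (mk⇔
    (λ x′≡y′ → Mod-+-cancelʳ M (Mod-trans (Mod-sym x′≡x+M) (Mod-trans x′≡y′ y′≡y+M)))
    (λ x≡y → Mod-trans x′≡x+M (Mod-trans (Mod-+ x≡y Mod-refl) (Mod-sym y′≡y+M))))

  newdegreeIsᵇ-σ : ∀ {x} → x < u → ∀ d → newdegreeIsᵇ N h₀ q (σ x) d ≡ newdegreeIsᵇ N h₀ q x d
  newdegreeIsᵇ-σ x<u zero    = refl
  newdegreeIsᵇ-σ x<u (suc d) =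
    cong₂ _∧_ (fixed (suc d)) (allBelow-cong d λ e → cong not (fixed (suc e)))
    where
    fixed : ∀ e → sameClassᵇ N h₀ (q ^ e * σ _) (σ _) ≡ sameClassᵇ N h₀ (q ^ e * _) _
    fixed e = sameClassᵇ-+M (frob-σ e x<u) (σ≡+M x<u)

  sameOrbitᵇ-σ : ∀ {a b} → a < u → b < u → sameOrbitᵇ N h₀ q D (σ a) (σ b) ≡ sameOrbitᵇ N h₀ q D a b
  sameOrbitᵇ-σ a<u b<u = anyBelow-cong D λ j → sameClassᵇ-+M (frob-σ j a<u) (σ≡+M b<u)

  twistIf : Bool → ℕ → ℕ
  twistIf true  x = σ x
  twistIf false x = x

  twist : ∀ {m} → Vec Bool m → Vec ℕ m → Vec ℕ m
  twist = Vec.zipWith twistIf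

  canonicalᵇ-twistIf : ∀ b x → canonicalᵇ N h₀ (twistIf b x) ≡ canonicalᵇ N h₀ x
  canonicalᵇ-twistIf true  x = canonicalᵇ-σ x
  canonicalᵇ-twistIf false x = refl

  degreeIsᵇ-twistIf : ∀ b {x} → x < u → ∀ d → degreeIsᵇ N q (twistIf b x) d ≡ degreeIsᵇ N q x d
  degreeIsᵇ-twistIf true  x<u = degreeIsᵇ-σ x<u
  degreeIsᵇ-twistIf false x<u d = refl

  newdegreeIsᵇ-twistIf : ∀ b {x} → x < u → ∀ d → newdegreeIsᵇ N h₀ q (twistIf b x) d ≡ newdegreeIsᵇ N h₀ q x d
  newdegreeIsᵇ-twistIf true  x<u = newdegreeIsᵇ-σ x<u
  newdegreeIsᵇ-twistIf false x<u d = refl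

  -- Twisted and untwisted entries have different degrees, hence lie in
  -- different orbits both before and after the twist.
  sameOrbitᵇ-twistIf : ∀ b b′ {x y dx dy} → x < u → y < u →
    degreeIsᵇ N q x dx ≡ true → degreeIsᵇ N q y dy ≡ true → (b ≢ b′ → dx ≢ dy) →
    sameOrbitᵇ N h₀ q D (twistIf b x) (twistIf b′ y) ≡ sameOrbitᵇ N h₀ q D x y
  sameOrbitᵇ-twistIf true  true  x<u y<u _ _ _ = sameOrbitᵇ-σ x<u y<u
  sameOrbitᵇ-twistIf false false x<u y<u _ _ _ = refl
  sameOrbitᵇ-twistIf true  false {dx = dx} x<u y<u deg-x deg-y apart = trans
    (degreeIsᵇ-≢⇒sameOrbitᵇ-false (trans (degreeIsᵇ-σ x<u dx) deg-x) deg-y (apart λ ()))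
    (sym (degreeIsᵇ-≢⇒sameOrbitᵇ-false deg-x deg-y (apart λ ())))
  sameOrbitᵇ-twistIf false true  {dy = dy} x<u y<u deg-x deg-y apart = trans
    (degreeIsᵇ-≢⇒sameOrbitᵇ-false deg-x (trans (degreeIsᵇ-σ y<u dy) deg-y) (apart λ ()))
    (sym (degreeIsᵇ-≢⇒sameOrbitᵇ-false deg-x deg-y (apart λ ())))

  admissibleᵇ-twist : ∀ dhat {m} (d : Vec ℕ m) (bs : Vec Bool m) →
    (∀ i j → lookup bs i ≢ lookup bs j → lookup d i ≢ lookup d j) →
    ∀ a → admissibleᵇ N h₀ q D dhat d (twist bs a) ≡ admissibleᵇ N h₀ q D dhat d a
  admissibleᵇ-twist dhat d bs apart a =
    ∧-cong-ifˡ canonical≡ λ canonical →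
    ∧-cong-ifʳ (cong₂ _∧_ (degrees≡ (below canonical)) (newdegrees≡ (below canonical))) λ degrees →
    orbits≡ (below canonical) (allFinᵇ⇒∀ _ (∧-conicalˡ _ _ degrees))
    where
    entry : ∀ i → lookup (twist bs a) i ≡ twistIf (lookup bs i) (lookup a i)
    entry i = Vec.lookup-zipWith twistIf i bs a
    canonical≡ : allFinᵇ (λ i → canonicalᵇ N h₀ (lookup (twist bs a) i))
               ≡ allFinᵇ (λ i → canonicalᵇ N h₀ (lookup a i))
    canonical≡ = allFinᵇ-cong λ i → trans (cong (canonicalᵇ N h₀) (entry i)) (canonicalᵇ-twistIf (lookup bs i) (lookup a i))
    below : allFinᵇ (λ i → canonicalᵇ N h₀ (lookup a i)) ≡ true → ∀ i → lookup a i < u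
    below canonical i = canonicalᵇ⇒< _ (allFinᵇ⇒∀ _ canonical i)
    degrees≡ : (∀ i → lookup a i < u) →
      allFinᵇ (λ i → degreeIsᵇ N q (lookup (twist bs a) i) (lookup d i))
      ≡ allFinᵇ (λ i → degreeIsᵇ N q (lookup a i) (lookup d i))
    degrees≡ a<u = allFinᵇ-cong λ i →
      trans (cong (λ x → degreeIsᵇ N q x (lookup d i)) (entry i)) (degreeIsᵇ-twistIf (lookup bs i) (a<u i) (lookup d i))
    newdegrees≡ : (∀ i → lookup a i < u) →
      allFinᵇ (λ i → newdegreeIsᵇ N h₀ q (lookup (twist bs a) i) dhat)
      ≡ allFinᵇ (λ i → newdegreeIsᵇ N h₀ q (lookup a i) dhat)
    newdegrees≡ a<u = allFinᵇ-cong λ i →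
      trans (cong (λ x → newdegreeIsᵇ N h₀ q x dhat) (entry i)) (newdegreeIsᵇ-twistIf (lookup bs i) (a<u i) dhat)
    orbits≡ : (∀ i → lookup a i < u) → (∀ i → degreeIsᵇ N q (lookup a i) (lookup d i) ≡ true) →
      distinctOrbitsᵇ N h₀ q D (twist bs a) ≡ distinctOrbitsᵇ N h₀ q D a
    orbits≡ a<u deg = allFinᵇ-cong λ i → allFinᵇ-cong λ j →
      cong (λ o → if does (i Fin.≟ j) then true else not o)
        (trans (cong₂ (sameOrbitᵇ N h₀ q D) (entry i) (entry j))
               (sameOrbitᵇ-twistIf (lookup bs i) (lookup bs j) (a<u i) (a<u j) (deg i) (deg j) (apart i j)))

  module TwistedSums {c ℓ : Level} (K : CommutativeRing c ℓ) where

    open PowersAndSums K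
    open R using (Carrier; _≈_; 0#; 1#; setoid) renaming (_*_ to _*ᴷ_)
    open import Relation.Binary.Reasoning.Setoid setoid
    open Rotation u
    open import Algebra.Properties.CommutativeSemigroup R.*-commutativeSemigroup using (interchange)

    sumMap-σ : ∀ (H : ℕ → Carrier) → sumMap (λ a → H (σ a)) (upTo N) ≈ sumMap H (upTo N)
    sumMap-σ H = subst (λ n → sumMap (λ a → H (σ a)) (upTo n) ≈ sumMap H (upTo n)) (m+[n∸m]≡n u≤N) (begin
      sumMap (λ a → H (σ a)) (upTo (u + r))
        ≈⟨ sumMap-applyUpTo-+ (λ a → H (σ a)) (λ i → i) u r ⟩
      sumMap (λ a → H (σ a)) (upTo u) R.+ sumMap (λ a → H (σ a)) (applyUpTo (u +_) r)
        ≈⟨ R.+-cong rotated unchanged ⟩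
      sumMap H (upTo u) R.+ sumMap H (applyUpTo (u +_) r)
        ≈⟨ sumMap-applyUpTo-+ H (λ i → i) u r ⟨
      sumMap H (upTo (u + r)) ∎)
      where
      r : ℕ
      r = N ∸ u
      rotated : sumMap (λ a → H (σ a)) (upTo u) ≈ sumMap H (upTo u)
      rotated = R.trans (sumMap-applyUpTo-cong u λ i i<u → R.reflexive (cong H (σ-< i<u))) (sumMap-rotate M H)
      unchanged : sumMap (λ a → H (σ a)) (applyUpTo (u +_) r) ≈ sumMap H (applyUpTo (u +_) r)
      unchanged = sumMap-applyUpTo-cong r λ i _ → R.reflexive (cong H (σ-≮ (m+n≮m u i)))

    sumMap-twistIf : ∀ b (H : ℕ → Carrier) → sumMap (λ a → H (twistIf b a)) (upTo N) ≈ sumMap H (upTo N)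
    sumMap-twistIf true  H = sumMap-σ H
    sumMap-twistIf false H = R.refl

    sumMap-twist : ∀ {m} (bs : Vec Bool m) (F : Vec ℕ m → Carrier) →
                   sumMap (λ a → F (twist bs a)) (allTuples m N) ≈ sumMap F (allTuples m N)
    sumMap-twist []       F = R.refl
    sumMap-twist {suc m} (b ∷ bs) F = begin
      sumMap (λ a → F (twist (b ∷ bs) a)) (concatMap rows (upTo N))
        ≈⟨ sumMap-concatMap _ rows (upTo N) ⟩
      sumMap (λ x → sumMap (λ a → F (twist (b ∷ bs) a)) (rows x)) (upTo N)
        ≈⟨ sumMap-cong (upTo N) (λ x →
             R.trans (sumMap-map _ (x ∷_) (allTuples m N)) (sumMap-twist bs (λ r → F (twistIf b x ∷ r)))) ⟩
      sumMap (λ x → row (twistIf b x)) (upTo N)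
        ≈⟨ sumMap-twistIf b row ⟩
      sumMap row (upTo N)
        ≈⟨ sumMap-cong (upTo N) (λ x → R.sym (sumMap-map F (x ∷_) (allTuples m N))) ⟩
      sumMap (λ x → sumMap F (rows x)) (upTo N)
        ≈⟨ sumMap-concatMap F rows (upTo N) ⟨
      sumMap F (concatMap rows (upTo N)) ∎
      where
      rows : ℕ → List (Vec ℕ (suc m))
      rows x = map (x ∷_) (allTuples m N)
      row : ℕ → Carrier
      row x = sumMap (λ r → F (x ∷ r)) (allTuples m N)

    module _ (ω : Carrier) (k : ℕ) (ω^uk≈1 : pow K ω (u * k) ≈ 1#) where

      W : Carrier
      W = evalChar K ω M k

      evalChar-σ : ∀ {x} → x < u → evalChar K ω (σ x) k ≈ evalChar K ω x k *ᴷ W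
      evalChar-σ {x} x<u = begin
        pow K ω (σ x * k)                                 ≈⟨ R.*-identityʳ _ ⟨
        pow K ω (σ x * k) *ᴷ 1#                           ≈⟨ R.*-cong R.refl (∣⇒pow≈1 (u * k) ω^uk≈1 (m∣m*n j)) ⟨
        pow K ω (σ x * k) *ᴷ pow K ω (u * k * j)          ≈⟨ pow-homo-* ω (σ x * k) (u * k * j) ⟨
        pow K ω (σ x * k + u * k * j)                     ≡⟨ cong (pow K ω) exponent ⟩
        pow K ω (x * k + M * k)                           ≈⟨ pow-homo-* ω (x * k) (M * k) ⟩
        pow K ω (x * k) *ᴷ pow K ω (M * k)                ∎
        where
        j : ℕ
        j = (x + M) / u
        regroup : ∀ r j u k → r * k + u * k * j ≡ (r + j * u) * k
        regroup = solve-∀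
        exponent : σ x * k + u * k * j ≡ x * k + M * k
        exponent = trans (regroup (σ x) j u k) (trans (cong (_* k) (σ+multiple≡+M x<u)) (*-distribʳ-+ k x M))

      prodTerm-twist : ∀ {m} (bs : Vec Bool m) (lam a : Vec ℕ m) → (∀ i → lookup a i < u) →
        prodTerm K ω k lam (twist bs a) ≈ prodTerm K ω k lam a *ᴷ pow K W (selectedSum bs lam)
      prodTerm-twist []           []        []       _   = R.sym (R.*-identityʳ 1#)
      prodTerm-twist (true  ∷ bs) (l ∷ lam) (x ∷ a) a<u = begin
        pow K (evalChar K ω (σ x) k) l *ᴷ prodTerm K ω k lam (twist bs a)
          ≈⟨ R.*-cong (R.trans (pow-congˡ l (evalChar-σ (a<u fzero))) (pow-distrib-* _ W l))
                      (prodTerm-twist bs lam a (λ i → a<u (fsuc i))) ⟩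
        (pow K (evalChar K ω x k) l *ᴷ pow K W l) *ᴷ (prodTerm K ω k lam a *ᴷ pow K W (selectedSum bs lam))
          ≈⟨ interchange _ _ _ _ ⟩
        (pow K (evalChar K ω x k) l *ᴷ prodTerm K ω k lam a) *ᴷ (pow K W l *ᴷ pow K W (selectedSum bs lam))
          ≈⟨ R.*-cong R.refl (pow-homo-* W l (selectedSum bs lam)) ⟨
        (pow K (evalChar K ω x k) l *ᴷ prodTerm K ω k lam a) *ᴷ pow K W (l + selectedSum bs lam) ∎
      prodTerm-twist (false ∷ bs) (l ∷ lam) (x ∷ a) a<u = begin
        pow K (evalChar K ω x k) l *ᴷ prodTerm K ω k lam (twist bs a)
          ≈⟨ R.*-cong R.refl (prodTerm-twist bs lam a (λ i → a<u (fsuc i))) ⟩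
        pow K (evalChar K ω x k) l *ᴷ (prodTerm K ω k lam a *ᴷ pow K W (selectedSum bs lam))
          ≈⟨ R.*-assoc _ _ _ ⟨
        (pow K (evalChar K ω x k) l *ᴷ prodTerm K ω k lam a) *ᴷ pow K W (selectedSum bs lam) ∎

      Z-twist : ∀ dhat {m} (d lam : Vec ℕ m) (bs : Vec Bool m) →
        (∀ i j → lookup bs i ≢ lookup bs j → lookup d i ≢ lookup d j) →
        Z K ω q D N h₀ k dhat d lam ≈ Z K ω q D N h₀ k dhat d lam *ᴷ pow K W (selectedSum bs lam)
      Z-twist dhat {m} d lam bs apart = begin
        sumMap term (allTuples m N)                     ≈⟨ sumMap-twist bs term ⟨
        sumMap (λ a → term (twist bs a)) (allTuples m N) ≈⟨ sumMap-cong (allTuples m N) term-twist ⟩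
        sumMap (λ a → term a *ᴷ η) (allTuples m N)      ≈⟨ sumMap-*ʳ η term (allTuples m N) ⟩
        sumMap term (allTuples m N) *ᴷ η                ∎
        where
        η : Carrier
        η = pow K W (selectedSum bs lam)
        term : Vec ℕ m → Carrier
        term a = if admissibleᵇ N h₀ q D dhat d a then prodTerm K ω k lam a else 0#
        term-twist : ∀ a → term (twist bs a) ≈ term a *ᴷ η
        term-twist a rewrite admissibleᵇ-twist dhat d bs apart a with admissibleᵇ N h₀ q D dhat d a in admissible
        ... | true  = prodTerm-twist bs lam a λ i → canonicalᵇ⇒< _ (allFinᵇ⇒∀ _ (∧-conicalˡ _ _ admissible) i)
        ... | false = R.sym (R.zeroˡ η)

-- Arithmetic of the parameters

prime-power≥2 : ∀ {p e} → Prime p → 1 ≤ e → 2 ≤ p ^ e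
prime-power≥2 {p} {suc e} p-prime _ =
  ≤-trans (nonTrivial⇒n>1 p {{prime⇒nonTrivial p-prime}}) (m≤m*n p (p ^ e) {{m^n≢0 p e {{prime⇒nonZero p-prime}}}})

geometricSum : ℕ → ℕ → ℕ
geometricSum q zero    = 0
geometricSum q (suc d) = 1 + q * geometricSum q d

geometricSum-*-pred : ∀ Q d → geometricSum (1 + Q) d * Q + 1 ≡ (1 + Q) ^ d
geometricSum-*-pred Q zero    = refl
geometricSum-*-pred Q (suc d) = trans (regroup Q (geometricSum (1 + Q) d)) (cong ((1 + Q) *_) (geometricSum-*-pred Q d))
  where
  regroup : ∀ Q g → (1 + (1 + Q) * g) * Q + 1 ≡ (1 + Q) * (g * Q + 1)
  regroup = solve-∀

geometricSum-Mod : ∀ {n q} d → Mod n q 1 → Mod n (geometricSum q d) d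
geometricSum-Mod zero    q≡1 = Mod-refl
geometricSum-Mod (suc d) q≡1 = Mod-trans (Mod-+ (Mod-refl {x = 1}) (Mod-* q≡1 (geometricSum-Mod d q≡1)))
                                         (Mod-reflexive (cong suc (*-identityˡ d)))

-- M = (q^D - 1)/(q - 1) = 1 + q + ⋯ + q^(D-1), and each q^i ≡ 1 (mod n).
M≡D : ∀ {n q} D M → 2 ≤ q → n ∣ q ∸ 1 → M * (q ∸ 1) ≡ q ^ D ∸ 1 → Mod n M D
M≡D {n} {q} D M q≥2 n∣q∸1 M[q∸1]≡N =
  subst (λ x → Mod n x D) (sym M≡geometricSum) (geometricSum-Mod D (Mod-weaken n∣q∸1 (x≡1[x∸1] q≥1)))
  where
  q≥1 : 1 ≤ q
  q≥1 = ≤-trans (s≤s z≤n) q≥2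
  instance
    q∸1-nonZero : NonZero (q ∸ 1)
    q∸1-nonZero = >-nonZero (m<n⇒0<n∸m q≥2)
  geometricSum*[q∸1] : geometricSum q D * (q ∸ 1) ≡ q ^ D ∸ 1
  geometricSum*[q∸1] = trans (sym (m+n∸n≡m _ 1))
    (cong (_∸ 1) (subst (λ x → geometricSum x D * (q ∸ 1) + 1 ≡ x ^ D) (m+[n∸m]≡n q≥1) (geometricSum-*-pred (q ∸ 1) D)))
  M≡geometricSum : M ≡ geometricSum q D
  M≡geometricSum = *-cancelʳ-≡ M (geometricSum q D) (q ∸ 1) (trans M[q∸1]≡N (sym geometricSum*[q∸1]))

-- N(ζ_n^t̂) = ζ_n^(D t̂) = ζ_n^(d̂ t).
M*t̂≡d̂*t : ∀ {n q} D M t̂ dhat t → 2 ≤ q → n ∣ q ∸ 1 → M * (q ∸ 1) ≡ q ^ D ∸ 1 → t̂ * D ≡ dhat * t →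
          Mod n (M * t̂) (dhat * t)
M*t̂≡d̂*t {n} D M t̂ dhat t q≥2 n∣q∸1 M[q∸1]≡N t̂D≡d̂t =
  subst (Mod n (M * t̂)) (trans (*-comm D t̂) t̂D≡d̂t) (Mod-*ʳ t̂ (M≡D D M q≥2 n∣q∸1 M[q∸1]≡N))

M*t̂≡d̂*t⇒t∣M*t̂ : ∀ {n} dhat t Σλ M t̂ → n ≡ dhat * t * Σλ → Mod n (M * t̂) (dhat * t) → t ∣ M * t̂
M*t̂≡d̂*t⇒t∣M*t̂ dhat t Σλ M t̂ n≡ Mt̂≡d̂t =
  Mod-0⇒∣ (Mod-trans (Mod-weaken (divides (dhat * Σλ) (trans n≡ (regroup dhat t Σλ))) Mt̂≡d̂t) (Mod-multiple dhat))
  where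
  regroup : ∀ a b c → a * b * c ≡ a * c * b
  regroup = solve-∀

order-∣ : ∀ {N n z} .{{_ : NonZero n}} → (∀ k → 1 ≤ k → k < n → ¬ N ∣ k * z) → N ∣ n * z →
          ∀ Y → N ∣ Y * z → n ∣ Y
order-∣ {N} {n} {z} minimal N∣nz Y N∣Yz = m%n≡0⇒n∣m Y n (remainder≡0 (Y % n) refl)
  where
  N∣[Y%n]z : N ∣ Y % n * z
  N∣[Y%n]z = ∣m+n∣m⇒∣n (subst (N ∣_) split N∣Yz) (∣n⇒∣m*n (Y / n) N∣nz)
    where
    regroup : ∀ r y n z → (r + y * n) * z ≡ y * (n * z) + r * z
    regroup = solve-∀
    split : Y * z ≡ Y / n * (n * z) + Y % n * z
    split = trans (cong (_* z) (m≡m%n+[m/n]*n Y n)) (regroup (Y % n) (Y / n) n z)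
  remainder≡0 : ∀ r → r ≡ Y % n → Y % n ≡ 0
  remainder≡0 zero    r≡ = sym r≡
  remainder≡0 (suc r) r≡ = ⊥-elim (minimal (suc r) (s≤s z≤n) (subst (_< n) (sym r≡) (m%n<n Y n))
                                     (subst (λ x → N ∣ x * z) (sym r≡) N∣[Y%n]z))

matching : ∀ {m} → Vec ℕ m → ℕ → Vec Bool m
matching d y = Vec.map (λ x → does (x ≟ y)) d

matching-apart : ∀ {m} (d : Vec ℕ m) y i j → lookup (matching d y) i ≢ lookup (matching d y) j → lookup d i ≢ lookup d j
matching-apart d y i j bᵢ≢bⱼ dᵢ≡dⱼ = bᵢ≢bⱼ (begin
  lookup (matching d y) i    ≡⟨ Vec.lookup-map i _ d ⟩
  does (lookup d i ≟ y)      ≡⟨ cong (λ x → does (x ≟ y)) dᵢ≡dⱼ ⟩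
  does (lookup d j ≟ y)      ≡⟨ Vec.lookup-map j _ d ⟨
  lookup (matching d y) j    ∎)
  where open ≡-Reasoning

selectedSum-matching-bounds : ∀ {m} (d lam : Vec ℕ m) {i j} → All (1 ≤_) lam → lookup d i ≢ lookup d j →
  let Λ = selectedSum (matching d (lookup d i)) lam in 1 ≤ Λ × Λ < sum lam
selectedSum-matching-bounds d lam {i} {j} lam≥1 dᵢ≢dⱼ =
  ≤-trans (All.lookup⁺ lam≥1 i) (lookup≤selectedSum bs lam i bᵢ) ,
  (begin-strict
    Λ                                       <⟨ m<m+n Λ (All.lookup⁺ lam≥1 j) ⟩
    Λ + lookup lam j                        ≤⟨ +-monoʳ-≤ Λ (lookup≤selectedSum (Vec.map not bs) lam j ¬bⱼ) ⟩
    Λ + selectedSum (Vec.map not bs) lam    ≡⟨ selectedSum+complement bs lam ⟩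
    sum lam                                 ∎)
  where
  open ≤-Reasoning
  bs : Vec Bool _
  bs = matching d (lookup d i)
  Λ : ℕ
  Λ = selectedSum bs lam
  bᵢ : lookup bs i ≡ true
  bᵢ = trans (Vec.lookup-map i _ d) (dec-true (lookup d i ≟ lookup d i) refl)
  ¬bⱼ : lookup (Vec.map not bs) j ≡ true
  ¬bⱼ = trans (Vec.lookup-map j not bs)
          (cong not (trans (Vec.lookup-map j _ d) (dec-false (lookup d j ≟ lookup d i) (λ eq → dᵢ≢dⱼ (sym eq)))))

twistExponent-∤ : ∀ {N n} dhat t Σλ M t̂ z Λ .{{_ : NonZero n}} → n ≡ dhat * t * Σλ → Mod n (M * t̂) (dhat * t) →
  (∀ k → 1 ≤ k → k < n → ¬ N ∣ k * z) → N ∣ n * z → 1 ≤ Λ → Λ < Σλ → ¬ N ∣ M * (z * t̂) * Λ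
twistExponent-∤ {N} {n} dhat t Σλ M t̂ z Λ n≡ Mt̂≡dhat*t minimal N∣nz Λ≥1 Λ<Σλ N∣exponent =
  <⇒≱ Λ<Σλ (∣⇒≤ {{>-nonZero Λ≥1}} Σλ∣Λ)
  where
  regroup : ∀ M z t̂ Λ → M * (z * t̂) * Λ ≡ M * t̂ * Λ * z
  regroup = solve-∀
  n∣Mt̂Λ : n ∣ M * t̂ * Λ
  n∣Mt̂Λ = order-∣ minimal N∣nz _ (subst (N ∣_) (regroup M z t̂ Λ) N∣exponent)
  n∣dhat*t*Λ : n ∣ dhat * t * Λ
  n∣dhat*t*Λ = Mod-0⇒∣ (Mod-trans (Mod-sym (Mod-*ʳ Λ Mt̂≡dhat*t)) (∣⇒Mod-0 n∣Mt̂Λ))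
  Σλ∣Λ : Σλ ∣ Λ
  Σλ∣Λ = *-cancelˡ-∣ (dhat * t) {{dhat*t-nonZero}} (subst (_∣ dhat * t * Λ) n≡ n∣dhat*t*Λ)
    where
    dhat*t-nonZero : NonZero (dhat * t)
    dhat*t-nonZero = ≢-nonZero λ dhat*t≡0 → ≢-nonZero⁻¹ n (trans n≡ (cong (_* Σλ) dhat*t≡0))

lemma6p5 : ∀ {c ℓ : Level} (K : CommutativeRing c ℓ)
  -- K: an integral domain of characteristic 0 (stand-in for ℂ)
  → (∀ k → 1 ≤ k → ¬ CommutativeRing._≈_ K (fromℕ K k) (CommutativeRing.0# K))
  → (∀ x y → CommutativeRing._≈_ K (CommutativeRing._*_ K x y) (CommutativeRing.0# K)
       → CommutativeRing._≈_ K x (CommutativeRing.0# K) ⊎ CommutativeRing._≈_ K y (CommutativeRing.0# K))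
  -- the data n, d̂, t, λ
  → (n dhat t : ℕ) {m : ℕ} (lam : Vec ℕ m)
  → 1 ≤ n → 1 ≤ dhat → 1 ≤ t → All (1 ≤_) lam
  → n ≡ dhat * t * sum lam
  -- q a prime power with q ≡ 1 mod n, and s = (q-1)/t
  → (q : ℕ) → (∃ λ p → ∃ λ e → Prime p × 1 ≤ e × q ≡ p ^ e)
  → n ∣ q ∸ 1
  → (s : ℕ) → s * t ≡ q ∸ 1
  -- D with d̂ ∣ D ∣ d̂ t, and t̂ = d̂ t / D
  → (D : ℕ) → dhat ∣ D → D ∣ dhat * t
  → (that : ℕ) → that * D ≡ dhat * t
  -- d⃗ with d̂ ∣ d_i ∣ D
  → (d : Vec ℕ m) → All (λ di → dhat ∣ di × di ∣ D) d
  -- model of F_{q^D}^× = ⟨g⟩ of order q^D - 1; norm N(g) = g^M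
  → (M : ℕ) → M * (q ∸ 1) ≡ q ^ D ∸ 1
  -- δ: generator of Γ_1; δ∘N has exponent M*v (v a unit mod q-1)
  → (v : ℕ) → Coprime v (q ∸ 1)
  -- ζ_n = g^z, an element of order n
  → (z : ℕ) → (q ^ D ∸ 1) ∣ n * z
  → (∀ k → 1 ≤ k → k < n → ¬ ((q ^ D ∸ 1) ∣ k * z))
  -- ω = α(g) for the character with exponent 1: a primitive (q^D-1)-th root of unity
  → (ω : CommutativeRing.Carrier K) → PrimitiveRoot K ω (q ^ D ∸ 1)
  -- the entries of d⃗ are not all equal
  → (∃ λ (i : Fin m) → ∃ λ (j : Fin m) → lookup d i ≢ lookup d j)
  → CommutativeRing._≈_ K
      (Z K ω q D (q ^ D ∸ 1) (s * (M * v)) (z * that) dhat d lam)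
      (CommutativeRing.0# K)
lemma6p5 K _ domain n dhat t lam n≥1 dhat≥1 t≥1 lam≥1 n≡ q (_ , _ , p-prime , e≥1 , q≡pᵉ) n∣q∸1 s st≡q∸1
  D _ D∣dhat*t that that*D≡dhat*t d _ M M[q∸1]≡N v v⊥q∸1 z N∣nz z-order ω ω-primitive (i₀ , _ , dᵢ≢dⱼ) =
  x≈x*η⇒x≈0 domain _ η (Z-twist ω k ω^uk≈1 dhat d lam bs (matching-apart d (lookup d i₀))) η≉1
  where
  instance
    n-nonZero : NonZero n
    n-nonZero = >-nonZero n≥1
  q≥2 : 2 ≤ q
  q≥2 = subst (2 ≤_) (sym q≡pᵉ) (prime-power≥2 p-prime e≥1)
  D≥1 : 1 ≤ D
  D≥1 = n≢0⇒n>0 λ D≡0 → <⇒≢ (*-mono-≤ dhat≥1 t≥1) (sym (0∣⇒≡0 (subst (_∣ dhat * t) D≡0 D∣dhat*t)))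
  open Classes q D M s t v q≥2 D≥1 M[q∸1]≡N st≡q∸1 v⊥q∸1
  open TwistedSums K
  open PowersAndSums K
  k : ℕ
  k = z * that
  bs : Vec Bool _
  bs = matching d (lookup d i₀)
  η : R.Carrier
  η = pow K (evalChar K ω M k) (selectedSum bs lam)
  Mt̂≡dhat*t : Mod n (M * that) (dhat * t)
  Mt̂≡dhat*t = M*t̂≡d̂*t D M that dhat t q≥2 n∣q∸1 M[q∸1]≡N that*D≡dhat*t
  ω^uk≈1 : pow K ω (u * k) R.≈ R.1#
  ω^uk≈1 = ∣⇒pow≈1 N (proj₁ ω-primitive)
    (N∣u*[z*t̂] n∣q∸1 N∣nz (M*t̂≡d̂*t⇒t∣M*t̂ dhat t (sum lam) M that n≡ Mt̂≡dhat*t))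
  η≉1 : ¬ η R.≈ R.1#
  η≉1 η≈1 = let (Λ≥1 , Λ<Σλ) = selectedSum-matching-bounds d lam lam≥1 dᵢ≢dⱼ in
    twistExponent-∤ dhat t (sum lam) M that z (selectedSum bs lam) n≡ Mt̂≡dhat*t z-order N∣nz Λ≥1 Λ<Σλ
      (primitiveRoot⇒∣ ω-primitive _ (R.trans (pow-assocʳ ω (M * k) (selectedSum bs lam)) η≈1))
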